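{- Let $P$ be the Petersen graph and $\overline{P}$ its complement, and let $A_1, A_2 \subseteq V(\overline{P})$ with $|A_1| \ge |A_2| \ge 7$. Then there exist vertices $v_1 \in A_1$ and $v_2 \in A_2$ such that the graph obtained from $\overline{P}$ by adding, for each $i \in \{1,2\}$, all missing edges of $\overline{P}[A_i]$ incident to $v_i$ has a $K_8^=$ minor.
   Context: All graphs are finite and simple. $\overline{P}[A]$ denotes the subgraph induced by $A$; a missing edge of $\overline{P}[A]$ is a pair of nonadjacent vertices of $A$ in $\overline{P}$ (i.e., an edge of $P$ with both ends in $A$). $K_8^=$ is $K_8$ with two edges removed; "has a $K_8^=$ minor" means contains as a minor at least one of the two nonisomorphic graphs obtained from $K_8$ by deleting two edges. -}

module Defs where

open import Data.Nat using (ℕ; _≤_)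
open import Data.Bool using (Bool; true; false; _∧_; _∨_; not)
open import Data.Fin using (Fin; zero; suc; #_)
open import Data.Fin.Properties using (_≟_)
open import Data.Fin.Subset using (Subset)
open import Data.Vec using (Vec; []; _∷_; lookup)
open import Data.Maybe using (Maybe; just; nothing)
open import Data.Product using (Σ; _×_; _,_)
open import Data.Sum using (_⊎_)
open import Relation.Nullary.Decidable using (⌊_⌋)
open import Relation.Binary.PropositionalEquality using (_≡_)

Graph : ℕ → Set
Graph n = Fin n → Fin n → Bool

_==_ : {n : ℕ} → Fin n → Fin n → Bool
u == v = ⌊ u ≟ v ⌋

-- Petersen graph: vertex i is the i-th 2-subset of {0,..,4} (lexicographic order);
-- two vertices are adjacent iff the 2-subsets are disjoint.
pairs : Vec (Fin 5 × Fin 5) 10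
pairs = (# 0 , # 1) ∷ (# 0 , # 2) ∷ (# 0 , # 3) ∷ (# 0 , # 4) ∷ (# 1 , # 2)
      ∷ (# 1 , # 3) ∷ (# 1 , # 4) ∷ (# 2 , # 3) ∷ (# 2 , # 4) ∷ (# 3 , # 4) ∷ []

disjoint : Fin 5 × Fin 5 → Fin 5 × Fin 5 → Bool
disjoint (a , b) (c , d) = not (a == c ∨ a == d ∨ b == c ∨ b == d)

Petersen : Graph 10
Petersen u v = disjoint (lookup pairs u) (lookup pairs v)

complement : {n : ℕ} → Graph n → Graph n
complement G u v = not (u == v) ∧ not (G u v)

Pbar : Graph 10
Pbar = complement Petersen

-- the pair {u,w} is a pair {v, x} with x ∈ A, x ≠ v  (v is assumed to lie in A)
incidentPair : {n : ℕ} → Subset n → Fin n → Fin n → Fin n → Bool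
incidentPair A v u w =
  not (u == w) ∧ ((u == v ∧ lookup A w) ∨ (w == v ∧ lookup A u))

augment : Subset 10 → Subset 10 → Fin 10 → Fin 10 → Graph 10
augment A₁ A₂ v₁ v₂ u w =
  Pbar u w ∨ incidentPair A₁ v₁ u w ∨ incidentPair A₂ v₂ u w

data WalkIn {n : ℕ} (G : Graph n) (S : Fin n → Set) : Fin n → Fin n → Set where
  stay : ∀ {u} → S u → WalkIn G S u u
  step : ∀ {u w v} → S u → G u w ≡ true → WalkIn G S w v → WalkIn G S u v

-- Minor model of H in G: each vertex of G is assigned to at most one branch set
-- (so branch sets are pairwise disjoint); branch sets are nonempty and induce
-- connected subgraphs; every edge of H is realised by an edge of G between the
-- corresponding branch sets.
record MinorModel {m n : ℕ} (H : Graph m) (G : Graph n) : Set where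
  field
    φ         : Fin n → Maybe (Fin m)
    nonempty  : ∀ h → Σ (Fin n) (λ v → φ v ≡ just h)
    connected : ∀ h u v → φ u ≡ just h → φ v ≡ just h
                → WalkIn G (λ x → φ x ≡ just h) u v
    edges     : ∀ h h' → H h h' ≡ true →
                Σ (Fin n) (λ u → Σ (Fin n) (λ v →
                  φ u ≡ just h × φ v ≡ just h' × G u v ≡ true))

_≼_ : {m n : ℕ} → Graph m → Graph n → Set
H ≼ G = MinorModel H G

-- K₈ minus two edges sharing an end ({0,1},{0,2}) and minus two disjoint edges ({0,1},{2,3})
K8 : Graph 8
K8 u v = not (u == v)

edgeIs : Fin 8 → Fin 8 → Fin 8 → Fin 8 → Bool
edgeIs a b u v = (u == a ∧ v == b) ∨ (u == b ∧ v == a)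

K8minus2adj : Graph 8
K8minus2adj u v = K8 u v ∧ not (edgeIs (# 0) (# 1) u v ∨ edgeIs (# 0) (# 2) u v)

K8minus2disj : Graph 8
K8minus2disj u v = K8 u v ∧ not (edgeIs (# 0) (# 1) u v ∨ edgeIs (# 2) (# 3) u v)

HasK8=Minor : {n : ℕ} → Graph n → Set
HasK8=Minor G = (K8minus2adj ≼ G) ⊎ (K8minus2disj ≼ G)

{-# OPTIONS --safe #-}
module Submission where

-- A vertex set A of the Petersen graph with ∣A∣ ≥ 7 misses at most three vertices,
-- and since two Petersen vertices have at most one common neighbour, at least three
-- vertices of A keep two of their three Petersen neighbours inside A. Such a vertex v
-- is the centre of a cherry in A: a Petersen path through v, whose two edges are
-- missing edges of P̄[A] at v; we name it by v and the omitted neighbour m. So it is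
-- enough that P̄ plus two cherries, at v₁ avoiding m₁ and at v₂ ∉ {v₁, m₁}, has a
-- K₈^= minor, and three cherry centres in A₂ always offer such a v₂. The Petersen
-- graph is arc-transitive, so the first cherry may be fixed; for the 24 possible
-- second cherries, one of six contractions of two edges of P̄ yields K₈ minus two
-- disjoint edges.

open import Defs
open import Data.Bool using (true; false; _∧_; _∨_; not; b≤b)
  renaming (_≤_ to _≤ᵇ_)
open import Data.Bool.Properties using (≤-minimum; ≤-maximum; T-≡)
  renaming (_≟_ to _≟ᵇ_)
open import Data.Empty using (⊥-elim)
open import Data.Fin using (Fin; zero; suc; #_)
open import Data.Fin.Permutation using (Permutation′; permutation; _⟨$⟩ʳ_; _⟨$⟩ˡ_; inverseˡ; inverseʳ)
open import Data.Fin.Properties using (_≟_; all?; any?)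
open import Data.Fin.Subset using (Subset; _∈_; _∉_; _⊆_; ∣_∣; Nonempty; _-_; ⁅_⁆; inside; outside)
open import Data.Fin.Subset.Properties
  using (_⊆?_; drop-there; anySubset?; nonempty?; Empty-unique; ∣⊥∣≡0; p─⊥≡p; p─q⊆p)
open import Data.List using (List; []; _∷_)
open import Data.List.Relation.Unary.All as All using (All)
open import Data.List.Relation.Unary.Any as Any using (Any; here; there)
open import Data.Maybe using (Maybe; just; nothing)
import Data.Maybe.Properties as Maybe
open import Data.Nat using (ℕ; _≤_; _<_; _≤?_; suc; z≤n; s≤s; s≤s⁻¹)
open import Data.Nat.Properties using (≤-refl; ≤-trans; n≤1+n; <-irrefl)
open import Data.Product using (Σ; ∃; _×_; _,_; proj₁; proj₂)
open import Data.Product.Properties using (≡-dec)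
import Data.Sum as Sum
open import Data.Sum using (inj₂)
open import Data.Vec using (Vec; []; _∷_; lookup; tabulate)
open import Data.Vec.Properties using (lookup⇒[]=; []=⇒lookup; lookup∘tabulate)
open import Function.Bundles using (Equivalence)
open import Relation.Binary.PropositionalEquality
  using (_≡_; _≢_; refl; sym; trans; cong; cong₂; subst; subst₂; module ≡-Reasoning)
open import Relation.Nullary using (Dec; yes; no)
open import Relation.Nullary.Decidable
  using (⌊_⌋; isYes; does; isYes≗does; does-≡; dec-true; toWitness; from-yes; decidable-stable;
         map′; ¬?; _×-dec_; _⊎-dec_; _→-dec_)
open import Relation.Unary using (Pred; Decidable)

∧-mono-≤ : ∀ {a a′ b b′} → a ≤ᵇ a′ → b ≤ᵇ b′ → a ∧ b ≤ᵇ a′ ∧ b′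
∧-mono-≤ {false} _   _ = ≤-minimum _
∧-mono-≤ {true}  b≤b q = q

∨-mono-≤ : ∀ {a a′ b b′} → a ≤ᵇ a′ → b ≤ᵇ b′ → a ∨ b ≤ᵇ a′ ∨ b′
∨-mono-≤ {true}          b≤b _ = b≤b
∨-mono-≤ {false} {false} _   q = q
∨-mono-≤ {false} {true}  _   _ = ≤-maximum _

≤ᵇ-true : ∀ {a b} → a ≤ᵇ b → a ≡ true → b ≡ true
≤ᵇ-true b≤b refl = refl

_⊆ᴳ_ : ∀ {n} → Graph n → Graph n → Set
G ⊆ᴳ G′ = ∀ u w → G u w ≤ᵇ G′ u w

module _ {n} {G G′ : Graph n} (G⊆G′ : G ⊆ᴳ G′) where

  WalkIn-mono : ∀ {S u v} → WalkIn G S u v → WalkIn G′ S u v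
  WalkIn-mono (stay s)       = stay s
  WalkIn-mono (step s e uv) = step s (≤ᵇ-true (G⊆G′ _ _) e) (WalkIn-mono uv)

  ≼-mono : ∀ {m} {H : Graph m} → H ≼ G → H ≼ G′
  ≼-mono M = record
    { φ         = φ
    ; nonempty  = nonempty
    ; connected = λ h u v φu φv → WalkIn-mono (connected h u v φu φv)
    ; edges     = λ h h′ hh′ → let u , v , φu , φv , uv = edges h h′ hh′
                               in u , v , φu , φv , ≤ᵇ-true (G⊆G′ u v) uv
    }
    where open MinorModel M

HasK8=Minor-map : ∀ {n n′} {G : Graph n} {G′ : Graph n′} →
                  (∀ {H : Graph 8} → H ≼ G → H ≼ G′) → HasK8=Minor G → HasK8=Minor G′
HasK8=Minor-map f = Sum.map f f

_++ʷ_ : ∀ {n} {G : Graph n} {S u v w} → WalkIn G S u v → WalkIn G S v w → WalkIn G S u w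
stay _       ++ʷ vw = vw
step s e uv ++ʷ vw = step s e (uv ++ʷ vw)

record _≅_ {n} (G G′ : Graph n) : Set where
  field
    π         : Permutation′ n
    preserves : ∀ u w → G′ (π ⟨$⟩ʳ u) (π ⟨$⟩ʳ w) ≡ G u w

module _ {n} {G G′ : Graph n} (G≅G′ : G ≅ G′) where
  open _≅_ G≅G′

  private
    to : Fin n → Fin n
    to u = π ⟨$⟩ʳ u

    from : Fin n → Fin n
    from u = π ⟨$⟩ˡ u

  WalkIn-transport : ∀ {S u v} → WalkIn G S u v → WalkIn G′ (λ x → S (from x)) (to u) (to v)
  WalkIn-transport {S} (stay s) = stay (subst S (sym (inverseˡ π)) s)
  WalkIn-transport {S} {u} (step s e uv) =
    step (subst S (sym (inverseˡ π)) s) (trans (preserves u _) e) (WalkIn-transport uv)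

  ≼-transport : ∀ {m} {H : Graph m} → H ≼ G → H ≼ G′
  ≼-transport M = record
    { φ         = λ x → φ (from x)
    ; nonempty  = λ h → let u , φu = nonempty h in to u , relabel φu
    ; connected = λ h u v φu φv → subst₂ (WalkIn G′ _) (inverseʳ π) (inverseʳ π)
                                    (WalkIn-transport (connected h (from u) (from v) φu φv))
    ; edges     = λ h h′ hh′ → let u , v , φu , φv , uv = edges h h′ hh′
                               in to u , to v , relabel φu , relabel φv , trans (preserves u v) uv
    }
    where
    open MinorModel M

    relabel : ∀ {u h} → φ u ≡ just h → φ (from (to u)) ≡ just h
    relabel {h = h} = subst (λ x → φ x ≡ just h) (sym (inverseˡ π))

StarBranches : ℕ → ℕ → Set
StarBranches m n = Fin m → Fin n × List (Fin n)

module StarModel {m n} (H : Graph m) (G : Graph n) (branch : StarBranches m n) where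
  open import Data.List.Membership.DecPropositional (_≟_ {n}) using (find)
    renaming (_∈_ to _∈ₗ_; _∈?_ to _∈ₗ?_)

  centre : Fin m → Fin n
  centre h = proj₁ (branch h)

  leaves : Fin m → List (Fin n)
  leaves h = proj₂ (branch h)

  members : Fin m → List (Fin n)
  members h = centre h ∷ leaves h

  owner : Fin n → Maybe (Fin m)
  owner u with any? (λ h → u ∈ₗ? members h)
  ... | yes (h , _) = just h
  ... | no _        = nothing

  owner-sound : ∀ {u h} → owner u ≡ just h → u ∈ₗ members h
  owner-sound {u} eq with any? (λ h → u ∈ₗ? members h)
  owner-sound refl | yes (_ , u∈) = u∈

  record IsStarModel : Set where
    field
      owned    : ∀ h → All (λ u → owner u ≡ just h) (members h)
      spokes   : ∀ h → All (λ u → G (centre h) u ≡ true × G u (centre h) ≡ true) (leaves h)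
      realised : ∀ h h′ → H h h′ ≡ true →
                 Any (λ u → Any (λ w → G u w ≡ true) (members h′)) (members h)

  isStarModel? : Dec IsStarModel
  isStarModel? = map′ (λ (o , s , r) → record { owned = o ; spokes = s ; realised = r })
                      (λ M → IsStarModel.owned M , IsStarModel.spokes M , IsStarModel.realised M)
    (all? (λ h → All.all? (λ u → Maybe.≡-dec _≟_ (owner u) (just h)) (members h))
    ×-dec all? (λ h → All.all? (λ u → (G (centre h) u ≟ᵇ true) ×-dec (G u (centre h) ≟ᵇ true)) (leaves h))
    ×-dec all? (λ h → all? (λ h′ → (H h h′ ≟ᵇ true) →-dec
            Any.any? (λ u → Any.any? (λ w → G u w ≟ᵇ true) (members h′)) (members h))))

  starModel : IsStarModel → H ≼ G
  starModel M = record
    { φ         = owner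
    ; nonempty  = λ h → centre h , All.head (owned h)
    ; connected = λ h u v φu φv → toCentre (owner-sound φu) φu ++ʷ fromCentre (owner-sound φv) φv
    ; edges     = edges
    }
    where
    open IsStarModel M

    toCentre : ∀ {h u} → u ∈ₗ members h → owner u ≡ just h → WalkIn G (λ x → owner x ≡ just h) u (centre h)
    toCentre (here refl) φu = stay φu
    toCentre {h} (there u∈) φu = step φu (proj₂ (All.lookup (spokes h) u∈)) (stay (All.head (owned h)))

    fromCentre : ∀ {h u} → u ∈ₗ members h → owner u ≡ just h → WalkIn G (λ x → owner x ≡ just h) (centre h) u
    fromCentre (here refl) φu = stay φu
    fromCentre {h} (there u∈) φu = step (All.head (owned h)) (proj₁ (All.lookup (spokes h) u∈)) (stay φu)

    edges : ∀ h h′ → H h h′ ≡ true → Σ (Fin n) (λ u → Σ (Fin n) (λ w →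
              owner u ≡ just h × owner w ≡ just h′ × G u w ≡ true))
    edges h h′ hh′ =
      let u , u∈ , uw = find (realised h h′ hh′)
          w , w∈ , e  = find uw
      in u , w , All.lookup (owned h) u∈ , All.lookup (owned h′) w∈ , e

∣p∣≤1+∣p-x∣ : ∀ {n} (p : Subset n) x → ∣ p ∣ ≤ suc ∣ p - x ∣
∣p∣≤1+∣p-x∣ (outside ∷ p) zero    = subst (λ q → ∣ p ∣ ≤ suc ∣ q ∣) (sym (p─⊥≡p p)) (n≤1+n _)
∣p∣≤1+∣p-x∣ (inside  ∷ p) zero    = subst (λ q → suc ∣ p ∣ ≤ suc ∣ q ∣) (sym (p─⊥≡p p)) ≤-refl
∣p∣≤1+∣p-x∣ (outside ∷ p) (suc x) = ∣p∣≤1+∣p-x∣ p x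
∣p∣≤1+∣p-x∣ (inside  ∷ p) (suc x) = s≤s (∣p∣≤1+∣p-x∣ p x)

x∉p-x : ∀ {n} (p : Subset n) x → x ∉ p - x
x∉p-x (_ ∷ p) zero    ()
x∉p-x (_ ∷ p) (suc x) x∈p-x = x∉p-x p x (drop-there x∈p-x)

0<∣p∣⇒Nonempty : ∀ {n} (p : Subset n) → 0 < ∣ p ∣ → Nonempty p
0<∣p∣⇒Nonempty {n} p 0<∣p∣ with nonempty? p
... | yes ne = ne
... | no ¬ne = ⊥-elim (<-irrefl refl (subst (0 <_) (trans (cong ∣_∣ (Empty-unique ¬ne)) (∣⊥∣≡0 n)) 0<∣p∣))

avoid-two : ∀ {n} (p : Subset n) → 3 ≤ ∣ p ∣ → ∀ x y → ∃ λ v → v ∈ p × v ≢ x × v ≢ y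
avoid-two p 3≤∣p∣ x y =
  let v , v∈ = 0<∣p∣⇒Nonempty (p - x - y) (s≤s⁻¹ (s≤s⁻¹ 3≤2+∣p-x-y∣))
      v∈p-x = p─q⊆p (p - x) ⁅ y ⁆ v∈
  in v , p─q⊆p p ⁅ x ⁆ v∈p-x
       , (λ v≡x → x∉p-x p x (subst (_∈ p - x) v≡x v∈p-x))
       , (λ v≡y → x∉p-x (p - x) y (subst (_∈ p - x - y) v≡y v∈))
  where
  3≤2+∣p-x-y∣ : 3 ≤ suc (suc ∣ p - x - y ∣)
  3≤2+∣p-x-y∣ = ≤-trans 3≤∣p∣ (≤-trans (∣p∣≤1+∣p-x∣ p x) (s≤s (∣p∣≤1+∣p-x∣ (p - x) y)))

allSubset? : ∀ {n ℓ} {P : Pred (Subset n) ℓ} → Decidable P → Dec (∀ p → P p)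
allSubset? P? = map′ (λ ¬∃¬P p → decidable-stable (P? p) (λ ¬Pp → ¬∃¬P (p , ¬Pp)))
                     (λ ∀P (p , ¬Pp) → ¬Pp (∀P p))
                     (¬? (anySubset? (λ p → ¬? (P? p))))

search : ∀ {n ℓ} {P : Pred (Fin n) ℓ} → Decidable P → Fin n → Fin n
search P? default with any? P?
... | yes (x , _) = x
... | no _        = default

cherry : Fin 10 → Fin 10 → Subset 10
cherry v m = tabulate λ u → u == v ∨ (Petersen v u ∧ not (u == m))

cherryGraph : Fin 10 → Fin 10 → Fin 10 → Fin 10 → Graph 10
cherryGraph v₁ m₁ v₂ m₂ = augment (cherry v₁ m₁) (cherry v₂ m₂) v₁ v₂

module _ (α : Petersen ≅ Petersen) where
  open _≅_ α

  private
    σ : Fin 10 → Fin 10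
    σ u = π ⟨$⟩ʳ u

  σ-injective : ∀ {u w} → σ u ≡ σ w → u ≡ w
  σ-injective eq = trans (sym (inverseˡ π)) (trans (cong (π ⟨$⟩ˡ_) eq) (inverseˡ π))

  ==-natural : ∀ u w → (σ u == σ w) ≡ (u == w)
  ==-natural u w = begin
    isYes (σ u ≟ σ w)                                ≡⟨ isYes≗does (σ u ≟ σ w) ⟩
    does (σ u ≟ σ w)                                 ≡⟨ does-≡ (σ u ≟ σ w) (map′ (cong σ) σ-injective (u ≟ w)) ⟩
    does (u ≟ w)                                     ≡⟨ sym (isYes≗does (u ≟ w)) ⟩
    isYes (u ≟ w)                                    ∎
    where open ≡-Reasoning

  cherry-natural : ∀ v m u → lookup (cherry (σ v) (σ m)) (σ u) ≡ lookup (cherry v m) u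
  cherry-natural v m u
    rewrite lookup∘tabulate (λ x → x == σ v ∨ (Petersen (σ v) x ∧ not (x == σ m))) (σ u)
          | lookup∘tabulate (λ x → x == v ∨ (Petersen v x ∧ not (x == m))) u
          | ==-natural u v | ==-natural u m | preserves v u = refl

  Pbar-natural : ∀ u w → Pbar (σ u) (σ w) ≡ Pbar u w
  Pbar-natural u w = cong₂ (λ a b → not a ∧ not b) (==-natural u w) (preserves u w)

  incidentPair-natural : ∀ A A′ → (∀ u → lookup A′ (σ u) ≡ lookup A u) →
    ∀ v u w → incidentPair A′ (σ v) (σ u) (σ w) ≡ incidentPair A v u w
  incidentPair-natural _ _ A′∘σ≡A v u w
    rewrite ==-natural u w | ==-natural u v | ==-natural w v | A′∘σ≡A u | A′∘σ≡A w = refl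

  cherryGraph-≅ : ∀ v₁ m₁ v₂ m₂ → cherryGraph v₁ m₁ v₂ m₂ ≅ cherryGraph (σ v₁) (σ m₁) (σ v₂) (σ m₂)
  cherryGraph-≅ v₁ m₁ v₂ m₂ = record { π = π ; preserves = natural }
    where
    natural : ∀ u w → cherryGraph (σ v₁) (σ m₁) (σ v₂) (σ m₂) (σ u) (σ w) ≡ cherryGraph v₁ m₁ v₂ m₂ u w
    natural u w = cong₂ _∨_ (Pbar-natural u w) (cong₂ _∨_
      (incidentPair-natural (cherry v₁ m₁) (cherry (σ v₁) (σ m₁)) (cherry-natural v₁ m₁) v₁ u w)
      (incidentPair-natural (cherry v₂ m₂) (cherry (σ v₂) (σ m₂)) (cherry-natural v₂ m₂) v₂ u w))

-- The standard arc {0,1} → {3,4}; its cherry is {0,1}, {2,3}, {2,4}.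
v₀ m₀ : Fin 10
v₀ = # 0
m₀ = # 9

IsArcMap : (f f⁻¹ : Fin 10 → Fin 10) (v m : Fin 10) → Set
IsArcMap f f⁻¹ v m = (∀ u → f (f⁻¹ u) ≡ u) × (∀ u → f⁻¹ (f u) ≡ u)
                   × (∀ u w → Petersen (f u) (f w) ≡ Petersen u w) × f v₀ ≡ v × f m₀ ≡ m

-- arcMap v m is induced by the permutation 0,1,2,3,4 ↦ a,b,e,c,d of the ground set, where
-- v = {a,b}, m = {c,d} and e is the remaining element; it carries (v₀, m₀) to (v, m).
-- The block is opaque because unfolding these searches on symbolic vertices swamps the
-- type checker.
opaque
  vertexOf : Fin 5 → Fin 5 → Fin 10
  vertexOf a b = search (λ v → ≡-dec _≟_ _≟_ (lookup pairs v) (a , b) ⊎-dec ≡-dec _≟_ _≟_ (lookup pairs v) (b , a)) zero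

  arcMap : Fin 10 → Fin 10 → Fin 10 → Fin 10
  arcMap v m u = vertexOf (σ (proj₁ (lookup pairs u))) (σ (proj₂ (lookup pairs u)))
    where
    a b c d e : Fin 5
    a = proj₁ (lookup pairs v)
    b = proj₂ (lookup pairs v)
    c = proj₁ (lookup pairs m)
    d = proj₂ (lookup pairs m)
    e = search (λ i → ¬? (i ≟ a) ×-dec ¬? (i ≟ b) ×-dec ¬? (i ≟ c) ×-dec ¬? (i ≟ d)) zero
    σ : Fin 5 → Fin 5
    σ = lookup (a ∷ b ∷ e ∷ c ∷ d ∷ [])

  arcMap⁻¹ : Fin 10 → Fin 10 → Fin 10 → Fin 10
  arcMap⁻¹ v m u = search (λ x → arcMap v m x ≟ u) u

  isArcMap : ∀ v m → Petersen v m ≡ true → IsArcMap (arcMap v m) (arcMap⁻¹ v m) v m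
  isArcMap = from-yes (all? λ v → all? λ m → (Petersen v m ≟ᵇ true) →-dec
    (all? (λ u → arcMap v m (arcMap⁻¹ v m u) ≟ u) ×-dec all? (λ u → arcMap⁻¹ v m (arcMap v m u) ≟ u)
    ×-dec all? (λ u → all? λ w → Petersen (arcMap v m u) (arcMap v m w) ≟ᵇ Petersen u w)
    ×-dec arcMap v m v₀ ≟ v ×-dec arcMap v m m₀ ≟ m))

record ArcSymmetry (v m : Fin 10) : Set where
  field
    α    : Petersen ≅ Petersen
    α-v₀ : _≅_.π α ⟨$⟩ʳ v₀ ≡ v
    α-m₀ : _≅_.π α ⟨$⟩ʳ m₀ ≡ m

Petersen-arcTransitive : ∀ v m → Petersen v m ≡ true → ArcSymmetry v m
Petersen-arcTransitive v m vm =
  let f∘f⁻¹ , f⁻¹∘f , preserves , maps-v₀ , maps-m₀ = isArcMap v m vm in record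
  { α    = record { π = permutation (arcMap v m) (arcMap⁻¹ v m) f∘f⁻¹ f⁻¹∘f ; preserves = preserves }
  ; α-v₀ = maps-v₀
  ; α-m₀ = maps-m₀
  }

-- Branch sets (centre, leaves) of models of K₈ minus the edges 01 and 23, each contracting
-- two edges of P̄; found by exhaustive search so that every second cherry is served.
certificates : List (Vec (Fin 10 × List (Fin 10)) 8)
certificates =
  ((# 1 , []) ∷ (# 6 , []) ∷ (# 3 , []) ∷ (# 4 , []) ∷ (# 0 , []) ∷ (# 5 , # 2 ∷ []) ∷ (# 8 , []) ∷ (# 9 , # 7 ∷ []) ∷ [])
  ∷ ((# 1 , []) ∷ (# 5 , []) ∷ (# 2 , []) ∷ (# 4 , []) ∷ (# 0 , []) ∷ (# 6 , # 3 ∷ []) ∷ (# 7 , []) ∷ (# 9 , # 8 ∷ []) ∷ [])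
  ∷ ((# 3 , []) ∷ (# 4 , []) ∷ (# 5 , # 2 ∷ []) ∷ (# 8 , []) ∷ (# 0 , []) ∷ (# 1 , []) ∷ (# 6 , []) ∷ (# 9 , # 7 ∷ []) ∷ [])
  ∷ ((# 1 , []) ∷ (# 6 , []) ∷ (# 5 , # 2 ∷ []) ∷ (# 8 , []) ∷ (# 0 , []) ∷ (# 3 , []) ∷ (# 4 , []) ∷ (# 9 , # 7 ∷ []) ∷ [])
  ∷ ((# 2 , []) ∷ (# 4 , []) ∷ (# 6 , # 3 ∷ []) ∷ (# 7 , []) ∷ (# 0 , []) ∷ (# 1 , []) ∷ (# 5 , []) ∷ (# 9 , # 8 ∷ []) ∷ [])
  ∷ ((# 1 , []) ∷ (# 5 , []) ∷ (# 6 , # 3 ∷ []) ∷ (# 7 , []) ∷ (# 0 , []) ∷ (# 2 , []) ∷ (# 4 , []) ∷ (# 9 , # 8 ∷ []) ∷ [])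
  ∷ []

IsModelFor : Graph 10 → Vec (Fin 10 × List (Fin 10)) 8 → Set
IsModelFor G B = StarModel.IsStarModel K8minus2disj G (lookup B)

standardCherry-certified : ∀ v m → Petersen v m ≡ true → v ≢ v₀ → v ≢ m₀ →
  Any (IsModelFor (cherryGraph v₀ m₀ v m)) certificates
standardCherry-certified = from-yes (all? λ v → all? λ m →
  (Petersen v m ≟ᵇ true) →-dec ¬? (v ≟ v₀) →-dec ¬? (v ≟ m₀) →-dec
  Any.any? (λ B → StarModel.isStarModel? K8minus2disj (cherryGraph v₀ m₀ v m) (lookup B)) certificates)

-- Pull the second cherry back along the symmetry carrying (v₀, m₀) to (v₁, m₁).
cherryGraph-minor : ∀ v₁ m₁ v₂ m₂ → Petersen v₁ m₁ ≡ true → Petersen v₂ m₂ ≡ true →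
  v₂ ≢ v₁ → v₂ ≢ m₁ → HasK8=Minor (cherryGraph v₁ m₁ v₂ m₂)
cherryGraph-minor v₁ m₁ v₂ m₂ v₁m₁ v₂m₂ v₂≢v₁ v₂≢m₁ =
  subst HasK8=Minor (trans (cong₂ (λ a b → cherryGraph a b (σ v₂′) (σ m₂′)) α-v₀ α-m₀)
                           (cong₂ (cherryGraph v₁ m₁) σv₂′ σm₂′))
    (HasK8=Minor-map (≼-transport (cherryGraph-≅ α v₀ m₀ v₂′ m₂′)) (inj₂ standardModel))
  where
  open ArcSymmetry (Petersen-arcTransitive v₁ m₁ v₁m₁)
  open _≅_ α
  σ σ⁻¹ : Fin 10 → Fin 10
  σ u = π ⟨$⟩ʳ u
  σ⁻¹ u = π ⟨$⟩ˡ u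
  v₂′ m₂′ : Fin 10
  v₂′ = σ⁻¹ v₂
  m₂′ = σ⁻¹ m₂
  σv₂′ : σ v₂′ ≡ v₂
  σv₂′ = inverseʳ π
  σm₂′ : σ m₂′ ≡ m₂
  σm₂′ = inverseʳ π
  v₂′m₂′ : Petersen v₂′ m₂′ ≡ true
  v₂′m₂′ = trans (sym (preserves v₂′ m₂′))
                 (subst₂ (λ a b → Petersen a b ≡ true) (sym σv₂′) (sym σm₂′) v₂m₂)
  v₂′≢v₀ : v₂′ ≢ v₀
  v₂′≢v₀ v₂′≡v₀ = v₂≢v₁ (trans (sym σv₂′) (trans (cong σ v₂′≡v₀) α-v₀))
  v₂′≢m₀ : v₂′ ≢ m₀
  v₂′≢m₀ v₂′≡m₀ = v₂≢m₁ (trans (sym σv₂′) (trans (cong σ v₂′≡m₀) α-m₀))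
  standardModel : K8minus2disj ≼ cherryGraph v₀ m₀ v₂′ m₂′
  standardModel = let B , M = Any.satisfied (standardCherry-certified v₂′ m₂′ v₂′m₂′ v₂′≢v₀ v₂′≢m₀)
                  in StarModel.starModel K8minus2disj (cherryGraph v₀ m₀ v₂′ m₂′) (lookup B) M

CherryIn : Subset 10 → Fin 10 → Set
CherryIn A v = ∃ λ m → Petersen v m ≡ true × cherry v m ⊆ A

cherryIn? : ∀ A v → Dec (CherryIn A v)
cherryIn? A v = any? λ m → (Petersen v m ≟ᵇ true) ×-dec (cherry v m ⊆? A)

cherryCentres : Subset 10 → Subset 10
cherryCentres A = tabulate λ v → ⌊ cherryIn? A v ⌋

∈cherryCentres⇒CherryIn : ∀ A {v} → v ∈ cherryCentres A → CherryIn A v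
∈cherryCentres⇒CherryIn A {v} v∈ =
  toWitness (Equivalence.from T-≡
    (trans (sym (lookup∘tabulate (λ v → ⌊ cherryIn? A v ⌋) v)) ([]=⇒lookup v∈)))

cherryCentres-large : ∀ A → 7 ≤ ∣ A ∣ → 3 ≤ ∣ cherryCentres A ∣
cherryCentres-large = from-yes (allSubset? λ A → (7 ≤? ∣ A ∣) →-dec (3 ≤? ∣ cherryCentres A ∣))

centre∈cherry : ∀ v m → v ∈ cherry v m
centre∈cherry v m = lookup⇒[]= v (cherry v m)
  (trans (lookup∘tabulate (λ u → u == v ∨ (Petersen v u ∧ not (u == m))) v)
         (cong (_∨ (Petersen v v ∧ not (v == m))) ==-refl))
  where
  ==-refl : (v == v) ≡ true
  ==-refl = trans (isYes≗does (v ≟ v)) (dec-true (v ≟ v) refl)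

cherryIn-nonempty : ∀ A → 7 ≤ ∣ A ∣ → ∃ (CherryIn A)
cherryIn-nonempty A 7≤∣A∣ =
  let v , v∈ = 0<∣p∣⇒Nonempty (cherryCentres A) (≤-trans (s≤s z≤n) (cherryCentres-large A 7≤∣A∣))
  in v , ∈cherryCentres⇒CherryIn A v∈

cherryIn-avoiding : ∀ A → 7 ≤ ∣ A ∣ → ∀ x y → ∃ λ v → v ≢ x × v ≢ y × CherryIn A v
cherryIn-avoiding A 7≤∣A∣ x y =
  let v , v∈ , v≢x , v≢y = avoid-two (cherryCentres A) (cherryCentres-large A 7≤∣A∣) x y
  in v , v≢x , v≢y , ∈cherryCentres⇒CherryIn A v∈

⊆⇒lookup-≤ : ∀ {n} {A A′ : Subset n} → A ⊆ A′ → ∀ u → lookup A u ≤ᵇ lookup A′ u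
⊆⇒lookup-≤ {A = A} A⊆A′ u with lookup A u in eq
... | false = ≤-minimum _
... | true  rewrite []=⇒lookup (A⊆A′ (lookup⇒[]= u A eq)) = b≤b

incidentPair-mono : ∀ {n} {A A′ : Subset n} → A ⊆ A′ → ∀ v → incidentPair A v ⊆ᴳ incidentPair A′ v
incidentPair-mono A⊆A′ v u w =
  ∧-mono-≤ {not (u == w)} b≤b (∨-mono-≤ (∧-mono-≤ {u == v} b≤b (⊆⇒lookup-≤ A⊆A′ w))
                                         (∧-mono-≤ {w == v} b≤b (⊆⇒lookup-≤ A⊆A′ u)))

augment-mono : ∀ {A₁ A₂ A₁′ A₂′} → A₁ ⊆ A₁′ → A₂ ⊆ A₂′ → ∀ v₁ v₂ →
  augment A₁ A₂ v₁ v₂ ⊆ᴳ augment A₁′ A₂′ v₁ v₂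
augment-mono A₁⊆A₁′ A₂⊆A₂′ v₁ v₂ u w =
  ∨-mono-≤ {Pbar u w} b≤b (∨-mono-≤ (incidentPair-mono A₁⊆A₁′ v₁ u w) (incidentPair-mono A₂⊆A₂′ v₂ u w))

twoCherries-minor : ∀ {A₁ A₂} v₁ m₁ v₂ m₂ → Petersen v₁ m₁ ≡ true → Petersen v₂ m₂ ≡ true →
  cherry v₁ m₁ ⊆ A₁ → cherry v₂ m₂ ⊆ A₂ → v₂ ≢ v₁ → v₂ ≢ m₁ → HasK8=Minor (augment A₁ A₂ v₁ v₂)
twoCherries-minor v₁ m₁ v₂ m₂ v₁m₁ v₂m₂ cherry₁⊆A₁ cherry₂⊆A₂ v₂≢v₁ v₂≢m₁ =
  HasK8=Minor-map (≼-mono (augment-mono cherry₁⊆A₁ cherry₂⊆A₂ v₁ v₂))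
                  (cherryGraph-minor v₁ m₁ v₂ m₂ v₁m₁ v₂m₂ v₂≢v₁ v₂≢m₁)

lemma2p12 : (A₁ A₂ : Subset 10) → ∣ A₂ ∣ ≤ ∣ A₁ ∣ → 7 ≤ ∣ A₂ ∣ →
    Σ (Fin 10) (λ v₁ → Σ (Fin 10) (λ v₂ →
      v₁ ∈ A₁ × v₂ ∈ A₂ × HasK8=Minor (augment A₁ A₂ v₁ v₂)))
lemma2p12 A₁ A₂ ∣A₂∣≤∣A₁∣ 7≤∣A₂∣ =
  let v₁ , m₁ , v₁m₁ , cherry₁⊆A₁ = cherryIn-nonempty A₁ (≤-trans 7≤∣A₂∣ ∣A₂∣≤∣A₁∣)
      v₂ , v₂≢v₁ , v₂≢m₁ , m₂ , v₂m₂ , cherry₂⊆A₂ = cherryIn-avoiding A₂ 7≤∣A₂∣ v₁ m₁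
  in v₁ , v₂ , cherry₁⊆A₁ (centre∈cherry v₁ m₁) , cherry₂⊆A₂ (centre∈cherry v₂ m₂)
   , twoCherries-minor v₁ m₁ v₂ m₂ v₁m₁ v₂m₂ cherry₁⊆A₁ cherry₂⊆A₂ v₂≢v₁ v₂≢m₁
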